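{- Let $0<\nu\ll\gamma<1/4$ and let $G=(V,E)$ be a $\gamma$-non-extremal graph on $n$ vertices with $\delta(G)\ge(1/2-\nu)n$. For a vertex $v\in V$ let $S_v=\{u\in V:\ \deg(u,\overline{N(v)})<\gamma n/2\}$, where $\overline{N(v)}=V\setminus N(v)$. Then for every vertex $v\in V$ with $\deg(v)\le n/2+\gamma n/2$ we have $|S_v|\le n/2-\gamma n/2$.
   Context: A graph $G$ on $n$ vertices is $\gamma$-non-extremal if for all (not necessarily disjoint) $A,B\subseteq V$ with $|A|=|B|=\lfloor n/2\rfloor$, the number $e(A,B)$ of edges with one endpoint in $A$ and the other in $B$ exceeds $\gamma n^2$. $N(v)$ is the neighbourhood of $v$ and $\deg(u,S)=|N(u)\cap S|$. The notation $\nu\ll\gamma$ means $\nu$ is sufficiently small compared to $\gamma$.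
   Formalization: The parameters γ and ν range over the rationals instead of the real numbers. -}

module Defs where

open import Data.Bool using (Bool; true; false; _∧_; _∨_; not)
open import Data.Nat as ℕ using (ℕ; zero; suc; _<ᵇ_)
open import Data.Fin using (Fin; toℕ)
import Data.Fin as Fin
open import Data.Integer using (+_)
open import Data.Rational using (ℚ; _/_)
open import Relation.Binary.PropositionalEquality using (_≡_)

record Graph (n : ℕ) : Set where
  field
    adj   : Fin n → Fin n → Bool
    sym   : ∀ x y → adj x y ≡ adj y x
    irrefl : ∀ x → adj x x ≡ false
open Graph public

VSet : ℕ → Set
VSet n = Fin n → Bool

count : ∀ {n} → (Fin n → Bool) → ℕ
count {zero}  p = 0
count {suc n} p = (if-then (p Fin.zero)) ℕ.+ count (λ i → p (Fin.suc i))
  where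
  if-then : Bool → ℕ
  if-then true  = 1
  if-then false = 0

sumFin : ∀ {n} → (Fin n → ℕ) → ℕ
sumFin {zero}  f = 0
sumFin {suc n} f = f Fin.zero ℕ.+ sumFin (λ i → f (Fin.suc i))

size : ∀ {n} → VSet n → ℕ
size S = count S

N : ∀ {n} → Graph n → Fin n → VSet n
N G v u = adj G v u

coN : ∀ {n} → Graph n → Fin n → VSet n
coN G v u = not (adj G v u)

degIn : ∀ {n} → Graph n → Fin n → VSet n → ℕ
degIn G u S = count (λ w → adj G u w ∧ S w)

deg : ∀ {n} → Graph n → Fin n → ℕ
deg G v = count (N G v)

-- e(A,B): number of edges {x,y} (counted once, x < y) with one endpoint
-- in A and the other in B (A, B not necessarily disjoint).
eAB : ∀ {n} → Graph n → VSet n → VSet n → ℕ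
eAB G A B = sumFin (λ x → count (λ y →
  (toℕ x <ᵇ toℕ y) ∧ adj G x y ∧ ((A x ∧ B y) ∨ (B x ∧ A y))))

ℕ→ℚ : ℕ → ℚ
ℕ→ℚ k = + k / 1

open import Data.Rational using (_<_; _*_)
open import Data.Rational.Properties using (_<?_)
open import Relation.Nullary.Decidable using (isYes)

S : ∀ {n} → Graph n → ℚ → Fin n → VSet n
S {n} G γ v u = isYes (ℕ→ℚ (degIn G u (coN G v)) <? γ * ℕ→ℚ n * (+ 1 / 2))

-- Suppose |S_v| > n/2 − γn/2 and let k = ⌊n/2⌋. Choose a k-set A that contains S_v or lies
-- inside it, and a k-set B that does the same for V ∖ N(v); as |V ∖ N(v)| ≥ n/2 − γn/2 by the
-- degree bound on v, both A ∖ S_v and B ∖ (V ∖ N(v)) have at most γn/2 vertices. Bounding e(A,B)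
-- by Σ_{x ∈ A} deg(x, B), each x ∈ A ∩ S_v contributes less than γn/2 + γn/2 and each
-- x ∈ A ∖ S_v at most k, so e(A,B) ≤ k·γn + (γn/2)·k ≤ (3/4)γn², against non-extremality.

module Submission where

open import Data.Bool using (Bool; true; false; _∧_; _∨_; not; T; if_then_else_)
open import Data.Bool.Properties using (T-∧; ∧-comm)
open import Data.Empty using (⊥; ⊥-elim)
open import Data.Fin using (Fin; zero; suc; toℕ)
open import Data.Integer as ℤ using (+_)
import Data.Integer.Properties as ℤ
open import Data.Nat as ℕ using (ℕ; zero; suc; _∸_; z≤n; s≤s; _<ᵇ_)
import Data.Nat.Properties as ℕ
open import Data.Nat.DivMod using (m/n≤m; m/n*n≤m)
open import Algebra.Properties.CommutativeMonoid.Sum ℕ.+-0-commutativeMonoid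
  using (sum; ∑-comm; ∑-distrib-+; sum-cong-≗)
open import Data.Product using (Σ; Σ-syntax; _×_; _,_; proj₁; proj₂)
open import Data.Rational using (ℚ; _/_; _<_; _≤_; _*_; _-_; _+_; 0ℚ; 1ℚ; toℚᵘ; NonNegative; nonNegative)
import Data.Rational.Properties as ℚ
open import Data.Rational.Solver using (module +-*-Solver)
open import Data.Rational.Unnormalised as ℚᵘ using (mkℚᵘ; *≡*; *≤*)
import Data.Rational.Unnormalised.Properties as ℚᵘ
open import Data.Sum using (inj₁; inj₂)
open import Data.Vec.Functional using (_∷_)
open import Function using (_∘_; Equivalence)
open import Relation.Binary.PropositionalEquality as ≡ using (_≡_; refl; cong; cong₂)
open import Relation.Nullary using (yes; no)
open import Relation.Nullary.Decidable using (toWitness)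
open import Defs

private
  variable
    n : ℕ

_∪_ _∩_ _∖_ : VSet n → VSet n → VSet n
(A ∪ B) x = A x ∨ B x
(A ∩ B) x = A x ∧ B x
(A ∖ B) x = A x ∧ not (B x)

_⊆_ : VSet n → VSet n → Set
A ⊆ B = ∀ x → T (A x) → T (B x)

∅ full : VSet n
∅ _ = false
full _ = true

𝟙 : Bool → ℕ
𝟙 b = if b then 1 else 0

sumOn : VSet n → (Fin n → ℕ) → ℕ
sumOn P f = sum (λ x → if P x then f x else 0)

NonExtremal : Graph n → ℚ → Set
NonExtremal {n} G γ = (A B : VSet n) → size A ≡ n ℕ./ 2 → size B ≡ n ℕ./ 2 →
  γ * (ℕ→ℚ n * ℕ→ℚ n) < ℕ→ℚ (eAB G A B)

sumFin≡sum : (f : Fin n → ℕ) → sumFin f ≡ sum f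
sumFin≡sum {zero}  f = refl
sumFin≡sum {suc n} f = cong (f zero ℕ.+_) (sumFin≡sum (f ∘ suc))

count≡sum : (P : VSet n) → count P ≡ sum (𝟙 ∘ P)
count≡sum {zero}  P = refl
count≡sum {suc n} P with P zero
... | true  = cong suc (count≡sum (P ∘ suc))
... | false = count≡sum (P ∘ suc)

sum-mono-≤ : {f g : Fin n → ℕ} → (∀ x → f x ℕ.≤ g x) → sum f ℕ.≤ sum g
sum-mono-≤ {zero}  f≤g = z≤n
sum-mono-≤ {suc n} f≤g = ℕ.+-mono-≤ (f≤g zero) (sum-mono-≤ (f≤g ∘ suc))

count-∅ : size (∅ {n}) ≡ 0
count-∅ {zero}  = refl
count-∅ {suc n} = count-∅ {n}

count-full : size (full {n}) ≡ n
count-full {zero}  = refl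
count-full {suc n} = cong suc (count-full {n})

count+count-not : (P : VSet n) → count P ℕ.+ count (not ∘ P) ≡ n
count+count-not {zero}  P = refl
count+count-not {suc n} P with P zero
... | true  = cong suc (count+count-not (P ∘ suc))
... | false = ≡.trans (ℕ.+-suc _ _) (cong suc (count+count-not (P ∘ suc)))

count-mono : {A B : VSet n} → A ⊆ B → count A ℕ.≤ count B
count-mono {zero}          A⊆B = z≤n
count-mono {suc n} {A} {B} A⊆B with A zero | B zero | A⊆B zero
... | true  | true  | _   = s≤s (count-mono (A⊆B ∘ suc))
... | true  | false | A⊆B₀ = ⊥-elim (A⊆B₀ _)
... | false | true  | _   = ℕ.m≤n⇒m≤1+n (count-mono (A⊆B ∘ suc))
... | false | false | _   = count-mono (A⊆B ∘ suc)

𝟙-∨ : ∀ a b → 𝟙 (a ∨ b) ℕ.≤ 𝟙 a ℕ.+ 𝟙 b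
𝟙-∨ true  b = s≤s z≤n
𝟙-∨ false b = ℕ.≤-refl

count-∪ : (A B : VSet n) → count (A ∪ B) ℕ.≤ count A ℕ.+ count B
count-∪ A B = begin
  count (A ∪ B)                         ≡⟨ count≡sum (A ∪ B) ⟩
  sum (λ x → 𝟙 (A x ∨ B x))             ≤⟨ sum-mono-≤ (λ x → 𝟙-∨ (A x) (B x)) ⟩
  sum (λ x → 𝟙 (A x) ℕ.+ 𝟙 (B x))       ≡⟨ ∑-distrib-+ (𝟙 ∘ A) (𝟙 ∘ B) ⟩
  sum (𝟙 ∘ A) ℕ.+ sum (𝟙 ∘ B)           ≡⟨ cong₂ ℕ._+_ (count≡sum A) (count≡sum B) ⟨
  count A ℕ.+ count B                   ∎
  where open ℕ.≤-Reasoning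

size-full∖ : (P : VSet n) → size (full ∖ P) ≡ n ∸ size P
size-full∖ P = ≡.trans (≡.sym (ℕ.m+n∸m≡n (count P) _)) (cong (_∸ count P) (count+count-not P))

∃-set-of-size-mostly-in : (P : VSet n) {k : ℕ} → k ℕ.≤ n →
  Σ[ A ∈ VSet n ] size A ≡ k × size (A ∖ P) ℕ.≤ k ∸ size P
∃-set-of-size-mostly-in P k≤n with ℕ.m≤n⇒m<n∨m≡n k≤n
... | inj₂ refl      = full , count-full , ℕ.≤-reflexive (size-full∖ P)
... | inj₁ (s≤s k≤m) = extend P k≤m
  where
  extend : (P : VSet (suc n)) {k : ℕ} → k ℕ.≤ n →
    Σ[ A ∈ VSet (suc n) ] size A ≡ k × size (A ∖ P) ℕ.≤ k ∸ size P
  extend P k≤n with P zero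
  ... | false = let A , |A|≡k , |A∖P|≤ = ∃-set-of-size-mostly-in (P ∘ suc) k≤n
                in false ∷ A , |A|≡k , |A∖P|≤
  extend {n} P {zero}  _   | true = ∅ , count-∅ {suc n} , ℕ.≤-reflexive (count-∅ {n})
  extend     P {suc k} k<n | true = let A , |A|≡k , |A∖P|≤ = ∃-set-of-size-mostly-in (P ∘ suc) (ℕ.<⇒≤ k<n)
                                    in true ∷ A , cong suc |A|≡k , |A∖P|≤

∑∑ : (Fin n → Fin n → ℕ) → ℕ
∑∑ f = sum (λ x → sum (f x))

∑∑-distrib-+ : (f g : Fin n → Fin n → ℕ) → ∑∑ (λ x y → f x y ℕ.+ g x y) ≡ ∑∑ f ℕ.+ ∑∑ g
∑∑-distrib-+ f g =
  ≡.trans (sum-cong-≗ (λ x → ∑-distrib-+ (f x) (g x))) (∑-distrib-+ (λ x → sum (f x)) (λ x → sum (g x)))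

sum-count≡∑∑ : (r : Fin n → Fin n → Bool) → sum (λ x → count (r x)) ≡ ∑∑ (λ x y → 𝟙 (r x y))
sum-count≡∑∑ r = sum-cong-≗ (λ x → count≡sum (r x))

_≺_ : Fin n → Fin n → Bool
x ≺ y = toℕ x <ᵇ toℕ y

≺-asym : (x y : Fin n) → T (x ≺ y) → T (y ≺ x) → ⊥
≺-asym x y x≺y y≺x = ℕ.<-asym (ℕ.<ᵇ⇒< (toℕ x) (toℕ y) x≺y) (ℕ.<ᵇ⇒< (toℕ y) (toℕ x) y≺x)

𝟙-∧-exclusive : ∀ a a′ b → (T a → T a′ → ⊥) → 𝟙 (a ∧ b) ℕ.+ 𝟙 (a′ ∧ b) ℕ.≤ 𝟙 b
𝟙-∧-exclusive true  true  b excl = ⊥-elim (excl _ _)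
𝟙-∧-exclusive true  false b excl = ℕ.≤-reflexive (ℕ.+-identityʳ (𝟙 b))
𝟙-∧-exclusive false true  b excl = ℕ.≤-refl
𝟙-∧-exclusive false false b excl = z≤n

count-unordered≤count-ordered : (r : Fin n → Fin n → Bool) →
  sum (λ x → count (λ y → x ≺ y ∧ (r x y ∨ r y x))) ℕ.≤ sum (λ x → count (r x))
count-unordered≤count-ordered r = begin
  sum (λ x → count (λ y → x ≺ y ∧ (r x y ∨ r y x)))
    ≡⟨ sum-count≡∑∑ (λ x y → x ≺ y ∧ (r x y ∨ r y x)) ⟩
  ∑∑ (λ x y → 𝟙 (x ≺ y ∧ (r x y ∨ r y x)))
    ≤⟨ sum-mono-≤ (λ x → sum-mono-≤ (λ y → split x y)) ⟩
  ∑∑ (λ x y → 𝟙 (x ≺ y ∧ r x y) ℕ.+ 𝟙 (x ≺ y ∧ r y x))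
    ≡⟨ ∑∑-distrib-+ (λ x y → 𝟙 (x ≺ y ∧ r x y)) (λ x y → 𝟙 (x ≺ y ∧ r y x)) ⟩
  ∑∑ (λ x y → 𝟙 (x ≺ y ∧ r x y)) ℕ.+ ∑∑ (λ x y → 𝟙 (x ≺ y ∧ r y x))
    ≡⟨ cong (∑∑ (λ x y → 𝟙 (x ≺ y ∧ r x y)) ℕ.+_) (∑-comm (λ x y → 𝟙 (x ≺ y ∧ r y x))) ⟩
  ∑∑ (λ x y → 𝟙 (x ≺ y ∧ r x y)) ℕ.+ ∑∑ (λ x y → 𝟙 (y ≺ x ∧ r x y))
    ≡⟨ ∑∑-distrib-+ (λ x y → 𝟙 (x ≺ y ∧ r x y)) (λ x y → 𝟙 (y ≺ x ∧ r x y)) ⟨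
  ∑∑ (λ x y → 𝟙 (x ≺ y ∧ r x y) ℕ.+ 𝟙 (y ≺ x ∧ r x y))
    ≤⟨ sum-mono-≤ (λ x → sum-mono-≤ (λ y → 𝟙-∧-exclusive (x ≺ y) (y ≺ x) (r x y) (≺-asym x y))) ⟩
  ∑∑ (λ x y → 𝟙 (r x y))
    ≡⟨ sum-count≡∑∑ r ⟨
  sum (λ x → count (r x))
    ∎
  where
  open ℕ.≤-Reasoning
  split : ∀ x y → 𝟙 (x ≺ y ∧ (r x y ∨ r y x)) ℕ.≤ 𝟙 (x ≺ y ∧ r x y) ℕ.+ 𝟙 (x ≺ y ∧ r y x)
  split x y with x ≺ y
  ... | true  = 𝟙-∨ (r x y) (r y x)
  ... | false = z≤n

eAB≤sumOn-degIn : (G : Graph n) (A B : VSet n) → eAB G A B ℕ.≤ sumOn A (λ x → degIn G x B)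
eAB≤sumOn-degIn {n} G A B = begin
  eAB G A B
    ≡⟨ sumFin≡sum (λ x → count (λ y → x ≺ y ∧ (adj G x y ∧ ((A x ∧ B y) ∨ (B x ∧ A y))))) ⟩
  sum (λ x → count (λ y → x ≺ y ∧ (adj G x y ∧ ((A x ∧ B y) ∨ (B x ∧ A y)))))
    ≤⟨ sum-mono-≤ (λ x → count-mono (edge⇒arc x)) ⟩
  sum (λ x → count (λ y → x ≺ y ∧ (arc x y ∨ arc y x)))
    ≤⟨ count-unordered≤count-ordered arc ⟩
  sum (λ x → count (arc x))
    ≡⟨ sum-cong-≗ arcs≡degIn ⟩
  sumOn A (λ x → degIn G x B)
    ∎
  where
  open ℕ.≤-Reasoning
  arc : Fin n → Fin n → Bool
  arc x y = A x ∧ (adj G x y ∧ B y)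
  edge⇒arc : ∀ x → (λ y → x ≺ y ∧ (adj G x y ∧ ((A x ∧ B y) ∨ (B x ∧ A y))))
                   ⊆ (λ y → x ≺ y ∧ (arc x y ∨ arc y x))
  edge⇒arc x y rewrite Graph.sym G y x | ∧-comm (B x) (A y) with x ≺ y | adj G x y
  ... | true  | true  = λ e → e
  ... | true  | false = λ ()
  ... | false | _     = λ ()
  arcs≡degIn : ∀ x → count (arc x) ≡ (if A x then degIn G x B else 0)
  arcs≡degIn x with A x
  ... | true  = refl
  ... | false = count-∅ {n}

sumOn-split : (P Q : VSet n) (f : Fin n → ℕ) → sumOn P f ≡ sumOn (P ∩ Q) f ℕ.+ sumOn (P ∖ Q) f
sumOn-split P Q f = ≡.trans (sum-cong-≗ split)
  (∑-distrib-+ (λ x → if P x ∧ Q x then f x else 0) (λ x → if P x ∧ not (Q x) then f x else 0))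
  where
  split : ∀ x → (if P x then f x else 0)
              ≡ (if P x ∧ Q x then f x else 0) ℕ.+ (if P x ∧ not (Q x) then f x else 0)
  split x with P x | Q x
  ... | true  | true  = ≡.sym (ℕ.+-identityʳ (f x))
  ... | true  | false = refl
  ... | false | _     = refl

degIn≤size : (G : Graph n) (x : Fin n) (B : VSet n) → degIn G x B ℕ.≤ size B
degIn≤size {n} G x B = count-mono {n} (λ y → proj₂ ∘ Equivalence.to T-∧)

degIn≤degIn+size∖ : (G : Graph n) (x : Fin n) (B Q : VSet n) →
  degIn G x B ℕ.≤ degIn G x Q ℕ.+ size (B ∖ Q)
degIn≤degIn+size∖ G x B Q = ℕ.≤-trans (count-mono split) (count-∪ (λ y → adj G x y ∧ Q y) (B ∖ Q))
  where
  split : ∀ y → T (adj G x y ∧ B y) → T ((adj G x y ∧ Q y) ∨ (B y ∧ not (Q y)))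
  split y with adj G x y | B y | Q y
  ... | true  | true  | true  = λ _ → _
  ... | true  | true  | false = λ _ → _
  ... | true  | false | _     = λ ()
  ... | false | _     | _     = λ ()

size-coN+deg : (G : Graph n) (v : Fin n) → size (coN G v) ℕ.+ deg G v ≡ n
size-coN+deg G v = ≡.trans (ℕ.+-comm (size (coN G v)) (deg G v)) (count+count-not (adj G v))

-- ℕ→ℚ k unfolds to fromℚᵘ (mkℚᵘ (+ k) 0).
toℚᵘ-ℕ→ℚ : ∀ k → toℚᵘ (ℕ→ℚ k) ℚᵘ.≃ mkℚᵘ (+ k) 0
toℚᵘ-ℕ→ℚ k = ℚ.toℚᵘ-fromℚᵘ (mkℚᵘ (+ k) 0)

ℕ→ℚ-+ : ∀ a b → ℕ→ℚ (a ℕ.+ b) ≡ ℕ→ℚ a + ℕ→ℚ b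
ℕ→ℚ-+ a b = ℚ.toℚᵘ-injective (begin
  toℚᵘ (ℕ→ℚ (a ℕ.+ b))               ≈⟨ toℚᵘ-ℕ→ℚ (a ℕ.+ b) ⟩
  mkℚᵘ (+ (a ℕ.+ b)) 0                ≈⟨ *≡* (cong (ℤ._* + 1) +[a+b]≡+a*1++b*1) ⟩
  mkℚᵘ (+ a) 0 ℚᵘ.+ mkℚᵘ (+ b) 0      ≈⟨ ℚᵘ.+-cong (toℚᵘ-ℕ→ℚ a) (toℚᵘ-ℕ→ℚ b) ⟨
  toℚᵘ (ℕ→ℚ a) ℚᵘ.+ toℚᵘ (ℕ→ℚ b)      ≈⟨ ℚ.toℚᵘ-homo-+ (ℕ→ℚ a) (ℕ→ℚ b) ⟨
  toℚᵘ (ℕ→ℚ a + ℕ→ℚ b)                ∎)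
  where
  open ℚᵘ.≃-Reasoning
  +[a+b]≡+a*1++b*1 : + (a ℕ.+ b) ≡ + a ℤ.* + 1 ℤ.+ + b ℤ.* + 1
  +[a+b]≡+a*1++b*1 = ≡.trans (ℤ.pos-+ a b) (≡.sym (cong₂ ℤ._+_ (ℤ.*-identityʳ (+ a)) (ℤ.*-identityʳ (+ b))))

ℕ→ℚ-mono-≤ : ∀ {a b} → a ℕ.≤ b → ℕ→ℚ a ≤ ℕ→ℚ b
ℕ→ℚ-mono-≤ {a} {b} a≤b = ℚ.toℚᵘ-cancel-≤ (begin
  toℚᵘ (ℕ→ℚ a)   ≃⟨ toℚᵘ-ℕ→ℚ a ⟩
  mkℚᵘ (+ a) 0   ≤⟨ *≤* (ℤ.*-monoʳ-≤-nonNeg (+ 1) (ℤ.+≤+ a≤b)) ⟩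
  mkℚᵘ (+ b) 0   ≃⟨ toℚᵘ-ℕ→ℚ b ⟨
  toℚᵘ (ℕ→ℚ b)   ∎)
  where open ℚᵘ.≤-Reasoning

ℕ→ℚ-nonNeg : ∀ k → NonNegative (ℕ→ℚ k)
ℕ→ℚ-nonNeg k = nonNegative (ℕ→ℚ-mono-≤ {0} {k} z≤n)

½ : ℚ
½ = + 1 / 2

ℕ→ℚ-∸ : ∀ {k s} → s ℕ.≤ k → ℕ→ℚ (k ∸ s) ≡ ℕ→ℚ k - ℕ→ℚ s
ℕ→ℚ-∸ {k} {s} s≤k = begin
  ℕ→ℚ (k ∸ s)                          ≡⟨ solve 2 (λ x s → x := (x :+ s) :- s) refl (ℕ→ℚ (k ∸ s)) (ℕ→ℚ s) ⟩
  (ℕ→ℚ (k ∸ s) + ℕ→ℚ s) - ℕ→ℚ s        ≡⟨ cong (_- ℕ→ℚ s) (ℕ→ℚ-+ (k ∸ s) s) ⟨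
  ℕ→ℚ (k ∸ s ℕ.+ s) - ℕ→ℚ s            ≡⟨ cong (λ m → ℕ→ℚ m - ℕ→ℚ s) (ℕ.m∸n+n≡m s≤k) ⟩
  ℕ→ℚ k - ℕ→ℚ s                        ∎
  where
  open ≡.≡-Reasoning
  open +-*-Solver

ℕ→ℚ-∸-≤ : ∀ {k s} {H M : ℚ} → ℕ→ℚ k ≤ H → H - M ≤ ℕ→ℚ s → 0ℚ ≤ M → ℕ→ℚ (k ∸ s) ≤ M
ℕ→ℚ-∸-≤ {k} {s} {H} {M} k≤H H-M≤s 0≤M with s ℕ.≤? k
... | no s≰k = ℚ.≤-trans (ℕ→ℚ-mono-≤ (ℕ.≤-reflexive (ℕ.m≤n⇒m∸n≡0 (ℕ.<⇒≤ (ℕ.≰⇒> s≰k))))) 0≤M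
... | yes s≤k = begin
  ℕ→ℚ (k ∸ s)      ≡⟨ ℕ→ℚ-∸ s≤k ⟩
  ℕ→ℚ k - ℕ→ℚ s    ≤⟨ ℚ.+-mono-≤ k≤H (ℚ.neg-antimono-≤ H-M≤s) ⟩
  H - (H - M)      ≡⟨ solve 2 (λ H M → H :- (H :- M) := M) refl H M ⟩
  M                ∎
  where
  open ℚ.≤-Reasoning
  open +-*-Solver

ℕ→ℚ-≤-half : ∀ {k n} → k ℕ.+ k ℕ.≤ n → ℕ→ℚ k ≤ ℕ→ℚ n * ½
ℕ→ℚ-≤-half {k} {n} k+k≤n = begin
  ℕ→ℚ k                      ≡⟨ solve 1 (λ K → K := (K :+ K) :* con ½) refl (ℕ→ℚ k) ⟩
  (ℕ→ℚ k + ℕ→ℚ k) * ½        ≡⟨ cong (_* ½) (ℕ→ℚ-+ k k) ⟨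
  ℕ→ℚ (k ℕ.+ k) * ½          ≤⟨ ℚ.*-monoʳ-≤-nonNeg ½ (ℕ→ℚ-mono-≤ k+k≤n) ⟩
  ℕ→ℚ n * ½                  ∎
  where
  open ℚ.≤-Reasoning
  open +-*-Solver

low-degree⇒large-coN : (G : Graph n) (v : Fin n) {M : ℚ} →
  ℕ→ℚ (deg G v) ≤ ℕ→ℚ n * ½ + M → ℕ→ℚ n * ½ - M ≤ ℕ→ℚ (size (coN G v))
low-degree⇒large-coN {n} G v {M} deg≤ = begin
  ℕ→ℚ n * ½ - M                    ≡⟨ solve 2 (λ N M → N :* con ½ :- M := N :- (N :* con ½ :+ M)) refl (ℕ→ℚ n) M ⟩
  ℕ→ℚ n - (ℕ→ℚ n * ½ + M)          ≤⟨ ℚ.+-monoʳ-≤ (ℕ→ℚ n) (ℚ.neg-antimono-≤ deg≤) ⟩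
  ℕ→ℚ n - ℕ→ℚ d                    ≡⟨ cong (λ m → ℕ→ℚ m - ℕ→ℚ d) (size-coN+deg G v) ⟨
  ℕ→ℚ (c ℕ.+ d) - ℕ→ℚ d            ≡⟨ ℕ→ℚ-∸ (ℕ.m≤n+m d c) ⟨
  ℕ→ℚ (c ℕ.+ d ∸ d)                ≡⟨ cong ℕ→ℚ (ℕ.m+n∸n≡m c d) ⟩
  ℕ→ℚ c                            ∎
  where
  open ℚ.≤-Reasoning
  open +-*-Solver
  c = size (coN G v)
  d = deg G v

sumOn-≤ : (P : VSet n) {f : Fin n → ℕ} {q : ℚ} → (∀ x → T (P x) → ℕ→ℚ (f x) ≤ q) →
  ℕ→ℚ (sumOn P f) ≤ ℕ→ℚ (size P) * q
sumOn-≤ {zero}  P {f} {q} _   = ℚ.≤-reflexive (≡.sym (ℚ.*-zeroˡ q))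
sumOn-≤ {suc n} P {f} {q} f≤q = step (P zero) (f≤q zero) (sumOn-≤ (P ∘ suc) (f≤q ∘ suc))
  where
  step : ∀ b → (T b → ℕ→ℚ (f zero) ≤ q) → ℕ→ℚ (sumOn (P ∘ suc) (f ∘ suc)) ≤ ℕ→ℚ (size (P ∘ suc)) * q →
         ℕ→ℚ (sumOn (b ∷ (P ∘ suc)) f) ≤ ℕ→ℚ (size (b ∷ (P ∘ suc))) * q
  step true  f₀≤q ih = begin
    ℕ→ℚ (f zero ℕ.+ sumOn (P ∘ suc) (f ∘ suc))     ≡⟨ ℕ→ℚ-+ (f zero) _ ⟩
    ℕ→ℚ (f zero) + ℕ→ℚ (sumOn (P ∘ suc) (f ∘ suc)) ≤⟨ ℚ.+-mono-≤ (f₀≤q _) ih ⟩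
    q + ℕ→ℚ (size (P ∘ suc)) * q                   ≡⟨ cong (_+ ℕ→ℚ (size (P ∘ suc)) * q) (ℚ.*-identityˡ q) ⟨
    1ℚ * q + ℕ→ℚ (size (P ∘ suc)) * q              ≡⟨ ℚ.*-distribʳ-+ q 1ℚ (ℕ→ℚ (size (P ∘ suc))) ⟨
    (1ℚ + ℕ→ℚ (size (P ∘ suc))) * q                ≡⟨ cong (_* q) (ℕ→ℚ-+ 1 (size (P ∘ suc))) ⟨
    ℕ→ℚ (suc (size (P ∘ suc))) * q                 ∎
    where open ℚ.≤-Reasoning
  step false _    ih = ih

eAB-split-bound : (G : Graph n) (A B P Q : VSet n) {M : ℚ} →
  (∀ x → T (P x) → ℕ→ℚ (degIn G x Q) ≤ M) →
  ℕ→ℚ (eAB G A B) ≤ ℕ→ℚ (size (A ∩ P)) * (M + ℕ→ℚ (size (B ∖ Q))) + ℕ→ℚ (size (A ∖ P)) * ℕ→ℚ (size B)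
eAB-split-bound {n} G A B P Q {M} deg≤M = begin
  ℕ→ℚ (eAB G A B)                                      ≤⟨ ℕ→ℚ-mono-≤ (eAB≤sumOn-degIn G A B) ⟩
  ℕ→ℚ (sumOn A degB)                                   ≡⟨ cong ℕ→ℚ (sumOn-split A P degB) ⟩
  ℕ→ℚ (sumOn (A ∩ P) degB ℕ.+ sumOn (A ∖ P) degB)      ≡⟨ ℕ→ℚ-+ (sumOn (A ∩ P) degB) _ ⟩
  ℕ→ℚ (sumOn (A ∩ P) degB) + ℕ→ℚ (sumOn (A ∖ P) degB)  ≤⟨ ℚ.+-mono-≤ (sumOn-≤ (A ∩ P) inP) (sumOn-≤ (A ∖ P) outP) ⟩
  ℕ→ℚ (size (A ∩ P)) * (M + ℕ→ℚ (size (B ∖ Q))) + ℕ→ℚ (size (A ∖ P)) * ℕ→ℚ (size B) ∎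
  where
  open ℚ.≤-Reasoning
  degB : Fin n → ℕ
  degB x = degIn G x B
  inP : ∀ x → T ((A ∩ P) x) → ℕ→ℚ (degB x) ≤ M + ℕ→ℚ (size (B ∖ Q))
  inP x x∈A∩P = begin
    ℕ→ℚ (degIn G x B)                          ≤⟨ ℕ→ℚ-mono-≤ (degIn≤degIn+size∖ G x B Q) ⟩
    ℕ→ℚ (degIn G x Q ℕ.+ size (B ∖ Q))         ≡⟨ ℕ→ℚ-+ (degIn G x Q) _ ⟩
    ℕ→ℚ (degIn G x Q) + ℕ→ℚ (size (B ∖ Q))     ≤⟨ ℚ.+-monoˡ-≤ _ (deg≤M x (proj₂ (Equivalence.to T-∧ x∈A∩P))) ⟩
    M + ℕ→ℚ (size (B ∖ Q))                     ∎
  outP : ∀ x → T ((A ∖ P) x) → ℕ→ℚ (degB x) ≤ ℕ→ℚ (size B)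
  outP x _ = ℕ→ℚ-mono-≤ (degIn≤size G x B)

γn/2-nonNeg : (γ : ℚ) .{{_ : NonNegative γ}} (n : ℕ) → NonNegative (γ * ℕ→ℚ n * ½)
γn/2-nonNeg γ n = ℚ.nonNeg*nonNeg⇒nonNeg (γ * ℕ→ℚ n) {{ℚ.nonNeg*nonNeg⇒nonNeg γ (ℕ→ℚ n) {{ℕ→ℚ-nonNeg n}}}} ½

sparse-budget : (γ : ℚ) .{{_ : NonNegative γ}} {n k a b x y : ℕ} →
  k ℕ.+ k ℕ.≤ n → a ℕ.≤ k → b ℕ.≤ k → ℕ→ℚ x ≤ γ * ℕ→ℚ n * ½ → ℕ→ℚ y ≤ γ * ℕ→ℚ n * ½ →
  ℕ→ℚ a * (γ * ℕ→ℚ n * ½ + ℕ→ℚ y) + ℕ→ℚ x * ℕ→ℚ b ≤ γ * (ℕ→ℚ n * ℕ→ℚ n)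
sparse-budget γ {n} {k} {a} {b} {x} {y} k+k≤n a≤k b≤k x≤M y≤M = begin
  A * (M + Y) + X * B
    ≤⟨ ℚ.+-mono-≤ (ℚ.*-monoʳ-≤-nonNeg (M + Y) {{M+Y≥0}} A≤H) (ℚ.*-monoˡ-≤-nonNeg X {{ℕ→ℚ-nonNeg x}} B≤H) ⟩
  H * (M + Y) + X * H
    ≤⟨ ℚ.+-mono-≤ (ℚ.*-monoˡ-≤-nonNeg H {{H≥0}} (ℚ.+-monoʳ-≤ M y≤M)) (ℚ.*-monoʳ-≤-nonNeg H {{H≥0}} x≤M) ⟩
  H * (M + M) + M * H    ≡⟨ solve 2 (λ γ N′ → N′ :* con ½ :* (γ :* N′ :* con ½ :+ γ :* N′ :* con ½) :+ γ :* N′ :* con ½ :* (N′ :* con ½)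
                                         := γ :* (N′ :* N′) :* con ¾) refl γ N′ ⟩
  γ * (N′ * N′) * ¾        ≤⟨ ℚ.*-monoˡ-≤-nonNeg (γ * (N′ * N′)) {{γNN≥0}} ¾≤1 ⟩
  γ * (N′ * N′) * 1ℚ       ≡⟨ ℚ.*-identityʳ (γ * (N′ * N′)) ⟩
  γ * (N′ * N′)            ∎
  where
  open ℚ.≤-Reasoning
  open +-*-Solver
  N′ A B X Y H M ¾ : ℚ
  N′ = ℕ→ℚ n
  A = ℕ→ℚ a
  B = ℕ→ℚ b
  X = ℕ→ℚ x
  Y = ℕ→ℚ y
  H = N′ * ½
  M = γ * N′ * ½
  ¾ = + 3 / 4
  ¾≤1 : ¾ ≤ 1ℚ
  ¾≤1 = toWitness {a? = ¾ ℚ.≤? 1ℚ} _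
  A≤H : A ≤ H
  A≤H = ℚ.≤-trans (ℕ→ℚ-mono-≤ a≤k) (ℕ→ℚ-≤-half {k} k+k≤n)
  B≤H : B ≤ H
  B≤H = ℚ.≤-trans (ℕ→ℚ-mono-≤ b≤k) (ℕ→ℚ-≤-half {k} k+k≤n)
  N′≥0 : NonNegative N′
  N′≥0 = ℕ→ℚ-nonNeg n
  H≥0 : NonNegative H
  H≥0 = ℚ.nonNeg*nonNeg⇒nonNeg N′ {{N′≥0}} ½
  M+Y≥0 : NonNegative (M + Y)
  M+Y≥0 = ℚ.nonNeg+nonNeg⇒nonNeg M {{γn/2-nonNeg γ n}} Y {{ℕ→ℚ-nonNeg y}}
  γNN≥0 : NonNegative (γ * (N′ * N′))
  γNN≥0 = ℚ.nonNeg*nonNeg⇒nonNeg γ (N′ * N′) {{ℚ.nonNeg*nonNeg⇒nonNeg N′ {{N′≥0}} N′ {{N′≥0}}}}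

n/2+n/2≤n : ∀ n → n ℕ./ 2 ℕ.+ n ℕ./ 2 ℕ.≤ n
n/2+n/2≤n n = begin
  k ℕ.+ k           ≡⟨ cong (k ℕ.+_) (ℕ.+-identityʳ k) ⟨
  2 ℕ.* k           ≡⟨ ℕ.*-comm 2 k ⟩
  k ℕ.* 2           ≤⟨ m/n*n≤m n 2 ⟩
  n                 ∎
  where
  open ℕ.≤-Reasoning
  k = n ℕ./ 2

size-∩≤size : (A P : VSet n) → size (A ∩ P) ℕ.≤ size A
size-∩≤size {n} A P = count-mono {n} (λ _ → proj₁ ∘ Equivalence.to T-∧)

large-S⇒sparse-pair : (G : Graph n) (γ : ℚ) .{{_ : NonNegative γ}} (v : Fin n) →
  ℕ→ℚ (deg G v) ≤ ℕ→ℚ n * ½ + γ * ℕ→ℚ n * ½ →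
  ℕ→ℚ n * ½ - γ * ℕ→ℚ n * ½ < ℕ→ℚ (size (S G γ v)) →
  Σ[ A ∈ VSet n ] Σ[ B ∈ VSet n ]
    size A ≡ n ℕ./ 2 × size B ≡ n ℕ./ 2 × ℕ→ℚ (eAB G A B) ≤ γ * (ℕ→ℚ n * ℕ→ℚ n)
large-S⇒sparse-pair {n} G γ v deg≤ S-large =
  let A , |A|≡k , |A∖S|≤ = ∃-set-of-size-mostly-in (S G γ v) (m/n≤m n 2)
      B , |B|≡k , |B∖Q|≤ = ∃-set-of-size-mostly-in (coN G v) (m/n≤m n 2)
  in A , B , |A|≡k , |B|≡k , (begin
    ℕ→ℚ (eAB G A B)
      ≤⟨ eAB-split-bound G A B (S G γ v) (coN G v) {M} (λ _ u∈S → ℚ.<⇒≤ (toWitness u∈S)) ⟩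
    ℕ→ℚ (size (A ∩ S G γ v)) * (M + ℕ→ℚ (size (B ∖ coN G v))) + ℕ→ℚ (size (A ∖ S G γ v)) * ℕ→ℚ (size B)
      ≤⟨ sparse-budget γ {n} {k} {size (A ∩ S G γ v)} {size B} {size (A ∖ S G γ v)} {size (B ∖ coN G v)}
           (n/2+n/2≤n n) (ℕ.≤-trans (size-∩≤size A (S G γ v)) (ℕ.≤-reflexive |A|≡k)) (ℕ.≤-reflexive |B|≡k)
           (bound (size (S G γ v)) |A∖S|≤ (ℚ.<⇒≤ S-large))
           (bound (size (coN G v)) |B∖Q|≤ (low-degree⇒large-coN G v deg≤)) ⟩
    γ * (ℕ→ℚ n * ℕ→ℚ n)
      ∎)
  where
  open ℚ.≤-Reasoning
  k = n ℕ./ 2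
  M = γ * ℕ→ℚ n * ½
  bound : ∀ {x} s → x ℕ.≤ k ∸ s → ℕ→ℚ n * ½ - M ≤ ℕ→ℚ s → ℕ→ℚ x ≤ M
  bound s x≤k∸s H-M≤s = ℚ.≤-trans (ℕ→ℚ-mono-≤ x≤k∸s)
    (ℕ→ℚ-∸-≤ {k} {s} (ℕ→ℚ-≤-half {k} (n/2+n/2≤n n)) H-M≤s (ℚ.nonNegative⁻¹ M {{γn/2-nonNeg γ n}}))

size-S≤ : (G : Graph n) (γ : ℚ) .{{_ : NonNegative γ}} → NonExtremal G γ → (v : Fin n) →
  ℕ→ℚ (deg G v) ≤ ℕ→ℚ n * ½ + γ * ℕ→ℚ n * ½ →
  ℕ→ℚ (size (S G γ v)) ≤ ℕ→ℚ n * ½ - γ * ℕ→ℚ n * ½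
size-S≤ G γ non-extremal v deg≤ = ℚ.≮⇒≥ λ S-large →
  let A , B , |A|≡k , |B|≡k , sparse = large-S⇒sparse-pair G γ v deg≤ S-large
  in ℚ.<-irrefl refl (ℚ.<-≤-trans (non-extremal A B |A|≡k |B|≡k) sparse)

lemma2 : (γ : ℚ) → 0ℚ < γ → γ < + 1 / 4 →
    Σ ℚ λ ν₀ → 0ℚ < ν₀ ×
      ((ν : ℚ) → 0ℚ < ν → ν < ν₀ →
       (n : ℕ) (G : Graph n) →
       -- γ-non-extremal
       ((A B : VSet n) → size A ≡ n ℕ./ 2 → size B ≡ n ℕ./ 2 →
          γ * (ℕ→ℚ n * ℕ→ℚ n) < ℕ→ℚ (eAB G A B)) →
       -- minimum degree
       ((v : Fin n) → (+ 1 / 2 - ν) * ℕ→ℚ n ≤ ℕ→ℚ (deg G v)) →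
       (v : Fin n) →
       ℕ→ℚ (deg G v) ≤ ℕ→ℚ n * (+ 1 / 2) + γ * ℕ→ℚ n * (+ 1 / 2) →
       ℕ→ℚ (size (S G γ v)) ≤ ℕ→ℚ n * (+ 1 / 2) - γ * ℕ→ℚ n * (+ 1 / 2))
lemma2 γ 0<γ _ = 1ℚ , ℚ.positive⁻¹ 1ℚ , λ _ _ _ n G non-extremal _ →
  size-S≤ G γ {{nonNegative (ℚ.<⇒≤ 0<γ)}} non-extremal
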